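{- Let $G$ be a graph and $T_1,\ldots,T_t$ even-cardinality subsets of $V(G)$ such that there exists at least one $(T_1,\ldots,T_t)$-even cut, and let $k$ be the minimum size of a $(T_1,\ldots,T_t)$-even cut in $G$. Then $(|V(G)|-2^t)k\le 4|E(G)|$.
   Context: For $X\subseteq V(G)$, $\delta_G(X)$ is the set of edges with one end in $X$ and the other in $V(G)\setminus X$. A $(T_1,\ldots,T_t)$-even cut is a set $\delta_G(X)$ with $\emptyset\subsetneq X\subsetneq V(G)$ and $|T_i\cap X|$ even for every $i\in\{1,\ldots,t\}$. -}

module Defs where

open import Data.Nat using (ℕ; _≤_)
open import Data.Nat.Divisibility using (_∣_)
open import Data.Bool using (Bool; _xor_)
open import Data.Fin using (Fin)
open import Data.Fin.Subset using (Subset; ∣_∣; _∩_; ∁; Nonempty)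
open import Data.Vec using (lookup)
open import Data.List using (List; filterᵇ; length)
open import Data.Product using (_×_; _,_; ∃)
open import Relation.Binary.PropositionalEquality using (_≡_)

-- A (multi)graph on vertex set Fin n: a finite list of edges (u , v).
-- Parallel edges and loops are allowed (loops never cross a cut).
Graph : ℕ → Set
Graph n = List (Fin n × Fin n)

Even : ℕ → Set
Even m = 2 ∣ m

crosses : ∀ {n} → Subset n → Fin n × Fin n → Bool
crosses X (u , v) = lookup X u xor lookup X v

δ : ∀ {n} → Graph n → Subset n → List (Fin n × Fin n)
δ E X = filterᵇ (crosses X) E

IsEvenCutSet : ∀ {n t} → (Fin t → Subset n) → Subset n → Set
IsEvenCutSet {n} {t} T X =
  Nonempty X × Nonempty (∁ X) × (∀ (i : Fin t) → Even ∣ T i ∩ X ∣)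

IsMinEvenCutSize : ∀ {n t} → Graph n → (Fin t → Subset n) → ℕ → Set
IsMinEvenCutSize E T k =
  ∃ (λ X → IsEvenCutSet T X × length (δ E X) ≡ k)
  × (∀ Y → IsEvenCutSet T Y → k ≤ length (δ E Y))

-- Group the vertices by which of T₁, …, Tₜ contain them. There are at most 2ᵗ
-- classes, and inside a class all vertices but at most one can be paired off, so
-- there are at least (n − 2ᵗ)/2 disjoint pairs {u, v} whose vertices lie in the same
-- sets Tᵢ. Each |Tᵢ ∩ {u, v}| is then 0 or 2, so for n ≥ 3 every such pair is an
-- even cut and k ≤ |δ({u, v})| ≤ deg u + deg v. Summing over the disjoint pairs
-- gives (n − 2ᵗ)/2 · k ≤ Σ deg = 2|E|.

module Submission where

open import Defs
open import Data.Nat using (ℕ; zero; suc; _≤_; _<_; _∸_; _+_; _*_; _^_; z≤n; s≤s; _≤?_)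
open import Data.Nat.Properties
  using (≤-refl; ≤-trans; ≤-reflexive; <⇒≢; ≰⇒>; n≤1+n; m≤n⇒m≤1+n; m≤m+n; m∸n≤m; m<n⇒0<n∸m; m≤n+o⇒m∸n≤o;
         +-comm; +-assoc; +-suc; *-suc; *-assoc; +-mono-≤; +-monoʳ-≤; *-mono-≤; *-monoˡ-≤; *-monoʳ-≤; module ≤-Reasoning)
open import Data.Nat.Divisibility using (∣-refl; _∣0)
open import Data.Nat.Tactic.RingSolver using (solve-∀)
open import Data.Bool using (Bool; true; false; T)
open import Data.Bool.Properties as Bool using (T-≡; ¬-not)
open import Data.Empty using (⊥-elim)
open import Data.Fin using (Fin; zero; suc)
open import Data.Fin.Properties using (_≟_)
open import Data.Fin.Subset using (Subset; ∣_∣; _∩_; _∪_; ∁; ⁅_⁆; ⊥; Nonempty)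
  renaming (_∈_ to _∈ˢ_)
open import Data.Fin.Subset.Properties
  using (_∈?_; x∈⁅x⁆; x∈⁅y⁆⇒x≡y; x∈p∪q⁺; x∈p∪q⁻; x∈p∩q⁺; x∈p∩q⁻; p∩q⊆q; ⊆-antisym;
         ∪-identityˡ; ∪-identityʳ; ∣⁅x⁆∣≡1; ∣⊥∣≡0; ∣∁p∣≡n∸∣p∣; nonempty?; Empty-unique)
open import Data.Vec using (lookup)
open import Data.Vec.Properties using (lookup⇒[]=; []=⇒lookup)
open import Data.List using (List; []; _∷_; _++_; length; filter; filterᵇ; map)
open import Data.Nat.ListAction using (sum)
open import Data.List.Properties using (length-++; length-filter; length-tabulate; map-cong-local; filter-reject)
open import Data.List.Membership.Propositional using (_∈_)
open import Data.List.Membership.Propositional.Properties using (∈-filter⁻; ∈-++⁻)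
open import Data.List.Relation.Binary.Subset.Propositional using (_⊆_)
open import Data.List.Relation.Binary.Disjoint.Propositional using (Disjoint)
open import Data.List.Relation.Unary.All as All using (All; []; _∷_)
open import Data.List.Relation.Unary.All.Properties using (anti-mono) renaming (++⁺ to All-++⁺)
open import Data.List.Relation.Unary.Any using (here; there)
open import Data.List.Relation.Unary.Unique.Propositional using (Unique; []; _∷_)
open import Data.List.Relation.Unary.Unique.Propositional.Properties as Unique using (allFin⁺)
open import Data.Product using (∃; _×_; _,_; proj₁; proj₂)
open import Data.Sum using (_⊎_; inj₁; inj₂; [_,_])
open import Function using (_∘_; id; Equivalence)
open import Relation.Binary.Definitions using (DecidableEquality)
open import Relation.Binary.PropositionalEquality using (_≡_; _≢_; refl; sym; trans; cong; subst; subst₂; module ≡-Reasoning)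
open import Relation.Nullary using (¬_; yes; no; ¬?)
open import Relation.Nullary.Decidable using (T?)
open import Relation.Unary using (Pred; Decidable)
open import Level using (0ℓ)

private
  variable
    A : Set
    n t : ℕ

module _ {P : Pred A 0ℓ} (P? : Decidable P) where

  length-filter+filter¬ : ∀ xs → length (filter P? xs) + length (filter (¬? ∘ P?) xs) ≡ length xs
  length-filter+filter¬ [] = refl
  length-filter+filter¬ (x ∷ xs) with ih ← length-filter+filter¬ xs | P? x
  ... | yes _ = cong suc ih
  ... | no _  = trans (+-suc _ _) (cong suc ih)

  length-filter-∷ : ∀ x xs → length (filter P? xs) ≤ length (filter P? (x ∷ xs))
  length-filter-∷ x xs with P? x
  ... | yes _ = n≤1+n _
  ... | no _  = ≤-refl

module _ {P Q R : Pred A 0ℓ} (P? : Decidable P) (Q? : Decidable Q) (R? : Decidable R)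
         (P⇒Q⊎R : ∀ {x} → P x → Q x ⊎ R x) where

  length-filter-⊎ : ∀ xs → length (filter P? xs) ≤ length (filter Q? xs) + length (filter R? xs)
  length-filter-⊎ [] = z≤n
  length-filter-⊎ (x ∷ xs) with ih ← length-filter-⊎ xs | P? x
  ... | no _ = ≤-trans ih (+-mono-≤ (length-filter-∷ Q? x xs) (length-filter-∷ R? x xs))
  ... | yes px with Q? x | R? x
  ...   | yes _ | no _  = s≤s ih
  ...   | yes _ | yes _ = s≤s (≤-trans ih (+-monoʳ-≤ _ (n≤1+n _)))
  ...   | no _  | yes _ = ≤-trans (s≤s ih) (≤-reflexive (sym (+-suc _ _)))
  ...   | no ¬q | no ¬r = ⊥-elim ([ ¬q , ¬r ] (P⇒Q⊎R px))

module _ (_≟ᴬ_ : DecidableEquality A) where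

  count : A → List A → ℕ
  count w xs = length (filter (_≟ᴬ w) xs)

  count-filter≢ : ∀ {w w′} → w ≢ w′ → ∀ xs → count w′ (filter (¬? ∘ (_≟ᴬ w)) xs) ≡ count w′ xs
  count-filter≢ w≢w′ [] = refl
  count-filter≢ {w} {w′} w≢w′ (x ∷ xs) with ih ← count-filter≢ w≢w′ xs | x ≟ᴬ w
  ... | yes refl = trans ih (sym (cong length (filter-reject (_≟ᴬ w′) w≢w′)))
  ... | no _ with x ≟ᴬ w′
  ...   | yes _ = cong suc ih
  ...   | no _  = ih

  sum-count≤length : ∀ {ws} → Unique ws → ∀ xs → sum (map (λ w → count w xs) ws) ≤ length xs
  sum-count≤length [] xs = z≤n
  sum-count≤length {w ∷ ws} (w∉ws ∷ ws-unique) xs = begin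
    count w xs + sum (map (λ w′ → count w′ xs) ws)
      ≡⟨ cong (λ s → count w xs + sum s) (map-cong-local (All.map (λ w≢w′ → sym (count-filter≢ w≢w′ xs)) w∉ws)) ⟩
    count w xs + sum (map (λ w′ → count w′ others) ws)
      ≤⟨ +-monoʳ-≤ (count w xs) (sum-count≤length ws-unique others) ⟩
    count w xs + length others
      ≡⟨ length-filter+filter¬ (_≟ᴬ w) xs ⟩
    length xs ∎
    where
    open ≤-Reasoning
    others : List A
    others = filter (¬? ∘ (_≟ᴬ w)) xs

ends : List (A × A) → List A
ends [] = []
ends ((u , v) ∷ ps) = u ∷ v ∷ ends ps

ends-++ : (ps qs : List (A × A)) → ends (ps ++ qs) ≡ ends ps ++ ends qs
ends-++ [] qs = refl
ends-++ ((u , v) ∷ ps) qs = cong (λ ws → u ∷ v ∷ ws) (ends-++ ps qs)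

length-ends : (ps : List (A × A)) → length (ends ps) ≡ 2 * length ps
length-ends [] = refl
length-ends (_ ∷ ps) = trans (cong (2 +_) (length-ends ps)) (sym (*-suc 2 (length ps)))

All-ends⁻ : {P : Pred A 0ℓ} (ps : List (A × A)) → All P (ends ps) → All (λ (u , v) → P u × P v) ps
All-ends⁻ [] [] = []
All-ends⁻ (_ ∷ ps) (pu ∷ pv ∷ rest) = (pu , pv) ∷ All-ends⁻ ps rest

length*≤sum-ends : ∀ {k} (g : A → ℕ) {ps : List (A × A)} →
  All (λ (u , v) → k ≤ g u + g v) ps → length ps * k ≤ sum (map g (ends ps))
length*≤sum-ends g [] = z≤n
length*≤sum-ends g {(u , v) ∷ ps} (k≤ ∷ rest) =
  ≤-trans (+-mono-≤ k≤ (length*≤sum-ends g rest)) (≤-reflexive (+-assoc (g u) (g v) _))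

Agree : (Fin t → A → Bool) → A × A → Set
Agree f (u , v) = ∀ i → f i u ≡ f i v

record Matching (f : Fin t → A → Bool) (xs : List A) : Set where
  field
    pairs   : List (A × A)
    agree   : All (Agree f) pairs
    unique  : Unique (ends pairs)
    ends⊆   : ends pairs ⊆ xs
    length≤ : length xs ≤ 2 * length pairs + 2 ^ t

matching₀ : (f : Fin 0 → A → Bool) {xs : List A} → Unique xs → Matching f xs
matching₀ f {[]} _ = record { pairs = [] ; agree = [] ; unique = [] ; ends⊆ = λ () ; length≤ = z≤n }
matching₀ f {_ ∷ []} _ = record { pairs = [] ; agree = [] ; unique = [] ; ends⊆ = λ () ; length≤ = s≤s z≤n }
matching₀ f {x ∷ y ∷ xs} ((x≢y ∷ x∉xs) ∷ y∉xs ∷ xs-unique) = record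
  { pairs   = (x , y) ∷ pairs
  ; agree   = (λ ()) ∷ agree
  ; unique  = (x≢y ∷ anti-mono ends⊆ x∉xs) ∷ anti-mono ends⊆ y∉xs ∷ unique
  ; ends⊆   = λ { (here refl) → here refl
                ; (there (here refl)) → there (here refl)
                ; (there (there w∈)) → there (there (ends⊆ w∈)) }
  ; length≤ = ≤-trans (s≤s (s≤s length≤)) (≤-reflexive (cong (_+ 1) (sym (*-suc 2 (length pairs)))))
  }
  where open Matching (matching₀ f xs-unique)

module _ {f : Fin (suc t) → A → Bool} {xs : List A} (b : Bool)
         (in-class : ∀ {x} → x ∈ xs → f zero x ≡ b) (M : Matching (f ∘ suc) xs) where

  open Matching M

  agree-extend : All (Agree f) pairs
  agree-extend = All.zipWith extend (All-ends⁻ pairs (All.tabulate (in-class ∘ ends⊆)) , agree)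
    where
    extend : ∀ {p} → (f zero (proj₁ p) ≡ b × f zero (proj₂ p) ≡ b) × Agree (f ∘ suc) p → Agree f p
    extend ((fu≡b , fv≡b) , _) zero = trans fu≡b (sym fv≡b)
    extend (_ , agree-suc) (suc i) = agree-suc i

matching : (f : Fin t → A → Bool) {xs : List A} → Unique xs → Matching f xs
matching {t = zero} f xs-unique = matching₀ f xs-unique
matching {t = suc t} {A = A} f {xs} xs-unique = record
  { pairs   = pairs₁ ++ pairs₀
  ; agree   = All-++⁺ (agree-extend true class₁ M₁) (agree-extend false class₀ M₀)
  ; unique  = subst Unique (sym (ends-++ pairs₁ pairs₀)) (Unique.++⁺ unique₁ unique₀ disjoint)
  ; ends⊆   = ends⊆xs ∘ subst (_ ∈_) (ends-++ pairs₁ pairs₀)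
  ; length≤ = begin
      length xs                                                   ≡⟨ sym (length-filter+filter¬ P? xs) ⟩
      length xs₁ + length xs₀                                     ≤⟨ +-mono-≤ length≤₁ length≤₀ ⟩
      (2 * length pairs₁ + 2 ^ t) + (2 * length pairs₀ + 2 ^ t)   ≡⟨ regroup (length pairs₁) (length pairs₀) (2 ^ t) ⟩
      2 * (length pairs₁ + length pairs₀) + 2 ^ suc t             ≡⟨ cong (λ m → 2 * m + 2 ^ suc t) (sym (length-++ pairs₁)) ⟩
      2 * length (pairs₁ ++ pairs₀) + 2 ^ suc t                   ∎
  }
  where
  open ≤-Reasoning
  P? : Decidable (λ x → f zero x ≡ true)
  P? x = f zero x Bool.≟ true
  xs₁ xs₀ : List A
  xs₁ = filter P? xs
  xs₀ = filter (¬? ∘ P?) xs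
  class₁ : ∀ {x} → x ∈ xs₁ → f zero x ≡ true
  class₁ = proj₂ ∘ ∈-filter⁻ P? {xs = xs}
  class₀ : ∀ {x} → x ∈ xs₀ → f zero x ≡ false
  class₀ = ¬-not ∘ proj₂ ∘ ∈-filter⁻ (¬? ∘ P?) {xs = xs}
  M₁ : Matching (f ∘ suc) xs₁
  M₁ = matching (f ∘ suc) (Unique.filter⁺ P? xs-unique)
  M₀ : Matching (f ∘ suc) xs₀
  M₀ = matching (f ∘ suc) (Unique.filter⁺ (¬? ∘ P?) xs-unique)
  open Matching M₁ renaming (pairs to pairs₁; unique to unique₁; ends⊆ to ends⊆₁; length≤ to length≤₁)
  open Matching M₀ renaming (pairs to pairs₀; unique to unique₀; ends⊆ to ends⊆₀; length≤ to length≤₀)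
  disjoint : Disjoint (ends pairs₁) (ends pairs₀)
  disjoint (w∈₁ , w∈₀) with () ← trans (sym (class₁ (ends⊆₁ w∈₁))) (class₀ (ends⊆₀ w∈₀))
  ends⊆xs : ends pairs₁ ++ ends pairs₀ ⊆ xs
  ends⊆xs w∈ with ∈-++⁻ (ends pairs₁) w∈
  ... | inj₁ w∈₁ = proj₁ (∈-filter⁻ P? (ends⊆₁ w∈₁))
  ... | inj₂ w∈₀ = proj₁ (∈-filter⁻ (¬? ∘ P?) (ends⊆₀ w∈₀))
  regroup : ∀ a b c → (2 * a + c) + (2 * b + c) ≡ 2 * (a + b) + 2 * c
  regroup = solve-∀

pair : Fin n → Fin n → Subset n
pair u v = ⁅ u ⁆ ∪ ⁅ v ⁆

∈-pair⁻ : ∀ {x u v : Fin n} → x ∈ˢ pair u v → x ≡ u ⊎ x ≡ v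
∈-pair⁻ {u = u} {v} x∈ with x∈p∪q⁻ ⁅ u ⁆ ⁅ v ⁆ x∈
... | inj₁ x∈u = inj₁ (x∈⁅y⁆⇒x≡y u x∈u)
... | inj₂ x∈v = inj₂ (x∈⁅y⁆⇒x≡y v x∈v)

∣pair∣≡2 : ∀ {u v : Fin n} → u ≢ v → ∣ pair u v ∣ ≡ 2
∣pair∣≡2 {u = zero} {zero} u≢v = ⊥-elim (u≢v refl)
∣pair∣≡2 {u = zero} {suc v} _ = cong suc (trans (cong ∣_∣ (∪-identityˡ ⁅ v ⁆)) (∣⁅x⁆∣≡1 v))
∣pair∣≡2 {u = suc u} {zero} _ = cong suc (trans (cong ∣_∣ (∪-identityʳ ⁅ u ⁆)) (∣⁅x⁆∣≡1 u))
∣pair∣≡2 {u = suc u} {suc v} u≢v = ∣pair∣≡2 (u≢v ∘ cong suc)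

∣p∣<n⇒Nonempty∁p : (p : Subset n) → ∣ p ∣ < n → Nonempty (∁ p)
∣p∣<n⇒Nonempty∁p {n} p ∣p∣<n with nonempty? (∁ p)
... | yes nonempty = nonempty
... | no empty = ⊥-elim (<⇒≢ (m<n⇒0<n∸m ∣p∣<n) (sym (begin
  n ∸ ∣ p ∣ ≡⟨ sym (∣∁p∣≡n∸∣p∣ p) ⟩
  ∣ ∁ p ∣   ≡⟨ cong ∣_∣ (Empty-unique empty) ⟩
  ∣ ⊥ {n} ∣ ≡⟨ ∣⊥∣≡0 n ⟩
  0         ∎)))
  where open ≡-Reasoning

∣∩pair∣-even : (S : Subset n) {u v : Fin n} → u ≢ v → lookup S u ≡ lookup S v → Even ∣ S ∩ pair u v ∣
∣∩pair∣-even {n} S {u} {v} u≢v same with u ∈? S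
... | yes u∈S = subst Even (sym (trans (cong ∣_∣ (⊆-antisym (p∩q⊆q S (pair u v)) pair⊆S∩pair)) (∣pair∣≡2 u≢v))) ∣-refl
  where
  v∈S : v ∈ˢ S
  v∈S = lookup⇒[]= v S (trans (sym same) ([]=⇒lookup u∈S))
  pair⊆S∩pair : ∀ {x} → x ∈ˢ pair u v → x ∈ˢ S ∩ pair u v
  pair⊆S∩pair x∈ = x∈p∩q⁺ ([ (λ { refl → u∈S }) , (λ { refl → v∈S }) ] (∈-pair⁻ x∈) , x∈)
... | no u∉S = subst Even (sym (trans (cong ∣_∣ (Empty-unique S∩pair-empty)) (∣⊥∣≡0 n))) (2 ∣0)
  where
  v∉S : ¬ v ∈ˢ S
  v∉S v∈S = u∉S (lookup⇒[]= u S (trans same ([]=⇒lookup v∈S)))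
  S∩pair-empty : ¬ Nonempty (S ∩ pair u v)
  S∩pair-empty (x , x∈) with x∈p∩q⁻ S (pair u v) x∈
  ... | x∈S , x∈pair = [ (λ { refl → u∉S x∈S }) , (λ { refl → v∉S x∈S }) ] (∈-pair⁻ x∈pair)

pair-isEvenCutSet : ∀ {t} (T : Fin t → Subset n) {u v : Fin n} → 3 ≤ n → u ≢ v →
  Agree (λ i → lookup (T i)) (u , v) → IsEvenCutSet T (pair u v)
pair-isEvenCutSet T {u} {v} 3≤n u≢v agree =
  (u , x∈p∪q⁺ (inj₁ (x∈⁅x⁆ u))) ,
  ∣p∣<n⇒Nonempty∁p (pair u v) (≤-trans (≤-reflexive (cong suc (∣pair∣≡2 u≢v))) 3≤n) ,
  λ i → ∣∩pair∣-even (T i) u≢v (agree i)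

degree : Graph n → Fin n → ℕ
degree E w = count _≟_ w (ends E)

∣δ∣≤ends-in : (E : Graph n) (X : Subset n) → length (δ E X) ≤ length (filterᵇ (lookup X) (ends E))
∣δ∣≤ends-in [] X = z≤n
-- The split is done in two stages: lookup X v only surfaces in the goal once
-- filterᵇ has consumed the case for u.
∣δ∣≤ends-in ((u , v) ∷ E) X with ih ← ∣δ∣≤ends-in E X | lookup X u
... | true with lookup X v
...   | true  = m≤n⇒m≤1+n (m≤n⇒m≤1+n ih)
...   | false = s≤s ih
∣δ∣≤ends-in ((u , v) ∷ E) X | false with lookup X v
...   | true  = s≤s ih
...   | false = ih

∣δ-pair∣≤degree+degree : (E : Graph n) (u v : Fin n) → length (δ E (pair u v)) ≤ degree E u + degree E v
∣δ-pair∣≤degree+degree E u v =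
  ≤-trans (∣δ∣≤ends-in E (pair u v)) (length-filter-⊎ (T? ∘ lookup (pair u v)) (_≟ u) (_≟ v) in-pair (ends E))
  where
  in-pair : ∀ {x} → T (lookup (pair u v) x) → x ≡ u ⊎ x ≡ v
  in-pair {x} = ∈-pair⁻ ∘ lookup⇒[]= x (pair u v) ∘ Equivalence.to T-≡

sum-degree≤ : (E : Graph n) {ws : List (Fin n)} → Unique ws → sum (map (degree E) ws) ≤ 2 * length E
sum-degree≤ E ws-unique = ≤-trans (sum-count≤length _≟_ ws-unique (ends E)) (≤-reflexive (length-ends E))

matched-pair-cut≤degrees : (E : Graph n) (T : Fin t → Subset n) {k : ℕ} →
  (∀ Y → IsEvenCutSet T Y → k ≤ length (δ E Y)) → 3 ≤ n →
  ∀ {ps} → All (Agree (λ i → lookup (T i))) ps → Unique (ends ps) →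
  All (λ (u , v) → k ≤ degree E u + degree E v) ps
matched-pair-cut≤degrees E T k-min 3≤n [] [] = []
matched-pair-cut≤degrees E T k-min 3≤n (agree ∷ agrees) ((u≢v ∷ _) ∷ _ ∷ unique) =
  ≤-trans (k-min _ (pair-isEvenCutSet T 3≤n u≢v agree)) (∣δ-pair∣≤degree+degree E _ _)
  ∷ matched-pair-cut≤degrees E T k-min 3≤n agrees unique

lemma2p1 : (n : ℕ) (E : Graph n) (t : ℕ) (T : Fin t → Subset n) →
    (∀ i → Even ∣ T i ∣) →
    ∃ (λ X → IsEvenCutSet T X) →
    (k : ℕ) → IsMinEvenCutSize E T k →
    (n ∸ 2 ^ t) * k ≤ 4 * length E
lemma2p1 n E t T _ _ k ((X , _ , ∣δX∣≡k) , k-min) with n ≤? 2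
... | yes n≤2 = *-mono-≤ (≤-trans (m∸n≤m n (2 ^ t)) (≤-trans n≤2 (m≤m+n 2 2))) k≤∣E∣
  where
  k≤∣E∣ : k ≤ length E
  k≤∣E∣ = subst (_≤ length E) ∣δX∣≡k (length-filter _ E)
... | no n≰2 = begin
  (n ∸ 2 ^ t) * k         ≤⟨ *-monoˡ-≤ k n∸2^t≤2∣pairs∣ ⟩
  (2 * length pairs) * k  ≡⟨ *-assoc 2 (length pairs) k ⟩
  2 * (length pairs * k)  ≤⟨ *-monoʳ-≤ 2 ∣pairs∣*k≤2∣E∣ ⟩
  2 * (2 * length E)      ≡⟨ sym (*-assoc 2 2 (length E)) ⟩
  4 * length E            ∎
  where
  open ≤-Reasoning
  open Matching (matching (λ i → lookup (T i)) (allFin⁺ n))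
  n∸2^t≤2∣pairs∣ : n ∸ 2 ^ t ≤ 2 * length pairs
  n∸2^t≤2∣pairs∣ = m≤n+o⇒m∸n≤o n (2 ^ t)
    (subst₂ _≤_ (length-tabulate id) (+-comm (2 * length pairs) (2 ^ t)) length≤)
  ∣pairs∣*k≤2∣E∣ : length pairs * k ≤ 2 * length E
  ∣pairs∣*k≤2∣E∣ = ≤-trans
    (length*≤sum-ends (degree E) (matched-pair-cut≤degrees E T k-min (≰⇒> n≰2) agree unique))
    (sum-degree≤ E unique)
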